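{- Let $M=(m_{i,j})$ be an $n\times n$ binary matrix ($1\le i,j\le n$). Then the scheme $S(M)$ is optimal if and only if $M$ is $k$-uniform for some $k$ with $0\le k\le n$ and, for each $j$ with $1\le j\le n-1$, there exists an assignment mapping $\phi_j$ such that (1) for every $i$ in the domain of $\phi_j$: $\phi_j(i)=i$ if and only if $m_{i,j}=m_{i,j+1}=1$; and (2) for every $i$ in the domain of $\phi_j$, writing $i'=\phi_j(i)$: $\sum_{l=1}^{j}m_{i',l}\le\sum_{l=1}^{j}m_{i,l}$.
   Context: Biker–hiker model: there are $n$ travellers $t_1,\dots,t_n$; the route has staging posts $P_0,P_1,\dots,P_n$ at unit spacing, and stage $s_j$ is the leg from $P_{j-1}$ to $P_j$ ($1\le j\le n$). All travellers start at $P_0$ at time $0$, every traveller walks at the same speed $w$ and cycles at the same speed $v>w$, and changing mode takes no time. An $n\times n$ binary matrix $M=(m_{i,j})$ defines the scheme $S(M)$: $t_i$ cycles stage $s_j$ if $m_{i,j}=1$ and walks it if $m_{i,j}=0$. $M$ is $k$-uniform if each row and each column of $M$ contains exactly $k$ entries equal to $1$. Bicycles start at $P_0$, move only when ridden (one rider at a time), and a traveller due to cycle $s_j$ must, upon arriving at $P_{j-1}$, take a bicycle that is present at $P_{j-1}$ at that moment (one he rode over $s_{j-1}$, or one left at $P_{j-1}$ by a traveller who rode $s_{j-1}$). $M$ (equivalently $S(M)$) is called optimal if $M$ is $k$-uniform for some $k$ and, with $k$ bicycles, the scheme $S(M)$ can be executed without any traveller ever having to wait at a post for a bicycle. For $1\le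 j\le n-1$, an assignment mapping $\phi_j$ is a one-to-one map from $\{i: m_{i,j}=1\}$ onto $\{i: m_{i,j+1}=1\}$ (interpreted as: the bicycle ridden by $t_i$ on $s_j$ is ridden by $t_{\phi_j(i)}$ on $s_{j+1}$). -}

module Defs where

open import Data.Bool using (Bool; true; false; if_then_else_)
open import Data.Nat as ℕ using (ℕ; zero; suc)
open import Data.Fin using (Fin; toℕ)
open import Data.Product using (Σ; ∃; _×_; _,_; proj₁; Σ-syntax; ∃-syntax)
open import Data.Rational as ℚ using (ℚ; 0ℚ; 1/_)
open import Data.Rational.Properties using (pos⇒nonZero; <-trans)
open import Function.Bundles using (_⤖_; Bijection)
open import Function.Definitions using (Injective)
open import Relation.Binary.PropositionalEquality using (_≡_)
open import Relation.Nullary.Decidable using (⌊_⌋)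

-- Binary n×n matrix: M i j = true  iff  m_{i,j} = 1.
-- Travellers and stages are indexed 0-based by Fin n:
-- traveller (i : Fin n) is t_{i+1}, stage (j : Fin n) is s_{j+1},
-- the leg from post P_{toℕ j} to post P_{suc (toℕ j)}.
BinMatrix : ℕ → Set
BinMatrix n = Fin n → Fin n → Bool

count : ∀ {n} → (Fin n → Bool) → ℕ
count {zero}  f = 0
count {suc n} f = (if f Data.Fin.zero then 1 else 0) ℕ.+ count (λ l → f (Data.Fin.suc l))

sumℚ : ∀ {n} → (Fin n → ℚ) → ℚ
sumℚ {zero}  f = 0ℚ
sumℚ {suc n} f = f Data.Fin.zero ℚ.+ sumℚ (λ l → f (Data.Fin.suc l))

Uniform : ∀ {n} → ℕ → BinMatrix n → Set
Uniform {n} k M = (∀ i → count (λ j → M i j) ≡ k) × (∀ j → count (λ i → M i j) ≡ k)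

-- number of stages among the first p stages (s_1..s_p) that t_i cycles:
-- Σ_{l=1}^{p} m_{i,l}
cycled : ∀ {n} → BinMatrix n → Fin n → ℕ → ℕ
cycled M i p = count (λ l → ⌊ toℕ l ℕ.<? p ⌋ Data.Bool.∧ M i l)

record Speeds : Set where
  field
    v   : ℚ
    w   : ℚ
    0<w : 0ℚ ℚ.< w
    w<v : w ℚ.< v

-- time needed for one unit-length stage, cycled (true) or walked (false)
stageTime : Speeds → Bool → ℚ
stageTime sp b = if b then (1/ v) {{nz v (<-trans 0<w w<v)}} else (1/ w) {{nz w 0<w}}
  where
  open Speeds sp
  nz : ∀ x → 0ℚ ℚ.< x → ℚ.NonZero x
  nz x 0<x = pos⇒nonZero x {{ℚ.positive 0<x}}

-- time at which t_i arrives at post P_p (p ≤ n) under S(M), never waiting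
arrival : ∀ {n} → Speeds → BinMatrix n → Fin n → ℕ → ℚ
arrival sp M i p = sumℚ (λ l → if ⌊ toℕ l ℕ.<? p ⌋ then stageTime sp (M i l) else 0ℚ)

Riders : ∀ {n} → BinMatrix n → Fin n → Set
Riders {n} M j = Σ[ i ∈ Fin n ] M i j ≡ true

Next : ∀ {n} → Fin n → Fin n → Set
Next j j' = toℕ j' ≡ suc (toℕ j)

-- An execution of S(M) with k bicycles (labelled Fin k) in which nobody waits:
-- for each stage j, the rider of each bicycle used on s_j (one rider per bicycle,
-- i.e. the map riders → bicycles is injective). All bicycles start at P_0, so
-- the first stage has no further constraint. A bicycle is at the start post P_j
-- of the next stage j' only if it was ridden over s_j, by some t_i, and it is
-- there from time arrival(t_i, P_j) on; t_{i'} must find it there on arrival.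
record NoWaitExecution {n} (sp : Speeds) (M : BinMatrix n) (k : ℕ) : Set where
  field
    bike     : (j : Fin n) → Riders M j → Fin k
    oneRider : (j : Fin n) → Injective _≡_ _≡_ (bike j)
    present  : (j j' : Fin n) → Next j j' → (r' : Riders M j') →
               ∃[ r ] (bike j r ≡ bike j' r' ×
                       arrival sp M (proj₁ r) (suc (toℕ j)) ℚ.≤ arrival sp M (proj₁ r') (suc (toℕ j)))

Optimal : ∀ {n} → Speeds → BinMatrix n → Set
Optimal sp M = ∃[ k ] (Uniform k M × NoWaitExecution sp M k)

AssignmentMapping : ∀ {n} → BinMatrix n → Fin n → Fin n → Set
AssignmentMapping M j j' = Riders M j ⤖ Riders M j'

{-# OPTIONS --safe #-}
-- A traveller's arrival time at P_p plus (1/w − 1/v) times the number of the first p stages he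
-- cycled is the walking time p/w, so "arrives no later" is the same as "has cycled at least as
-- many stages", which is condition (2).  Given a no-wait execution, the bicycles numbering the
-- riders of every stage make "follow your bicycle from s_j to s_{j+1}" an assignment mapping
-- satisfying (2); composing it with transpositions that send each traveller who cycles both
-- stages to himself keeps (2) and gives (1).  Conversely, numbering the riders of s_1 and
-- transporting the numbering along the φ_j labels the bicycles, and (2) says that everybody
-- finds his next bicycle already waiting.
module Submission where

open import Defs
open import Data.Bool using (Bool; true; false; if_then_else_; _∧_)
import Data.Bool.Properties as BoolP
open import Data.Nat as ℕ using (ℕ; zero; suc; _≤_)
import Data.Nat.Properties as ℕP
open import Data.Fin as Fin using (Fin; toℕ)
import Data.Fin.Properties as FinP
open import Data.Rational as ℚ using (ℚ; 0ℚ; _+_; _*_; -_; _-_)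
import Data.Rational.Properties as ℚP
open import Data.Product using (Σ; _×_; _,_; proj₁; proj₂; ∃-syntax; Σ-syntax)
open import Data.Sum using (_⊎_; inj₁; inj₂)
open import Data.Sum.Function.Propositional using (_⊎-↔_)
open import Data.List using (List; []; _∷_; allFin)
open import Data.List.Membership.Propositional using (_∈_)
open import Data.List.Membership.Propositional.Properties using (∈-allFin)
open import Data.List.Relation.Unary.Any using (here; there)
open import Algebra.Bundles using (CommutativeMonoid)
import Algebra.Properties.CommutativeSemigroup as CommutativeSemigroupProperties
open import Axiom.UniquenessOfIdentityProofs using (module Decidable⇒UIP)
open import Function.Base using (_∘_)
open import Function.Bundles using (_↔_; _⇔_; Inverse; Bijection; Injection; mk↔ₛ′; mk⤖; mk⇔)
open import Function.Definitions using (Injective; StrictlySurjective)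
open import Function.Consequences.Propositional using (strictlySurjective⇒surjective)
open import Function.Properties.Inverse using (↔-sym; ↔-trans; ↔⇒↣; ↔⇒⤖)
open import Function.Properties.Bijection using (⤖⇒↔)
open import Relation.Binary.Definitions using (DecidableEquality)
open import Relation.Binary.PropositionalEquality
open import Relation.Nullary using (Dec; yes; no; contradiction)
open import Relation.Nullary.Decidable using (⌊_⌋; map′)

open CommutativeSemigroupProperties (CommutativeMonoid.commutativeSemigroup ℚP.+-0-commutativeMonoid)
  using (interchange)

module Timing (sp : Speeds) where
  open Speeds sp

  cycleTime walkTime : ℚ
  cycleTime = stageTime sp true
  walkTime  = stageTime sp false

  private
    instance
      v-positive : ℚ.Positive v
      v-positive = ℚ.positive (ℚP.<-trans 0<w w<v)
      w-positive : ℚ.Positive w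
      w-positive = ℚ.positive 0<w
      v-nonZero : ℚ.NonZero v
      v-nonZero = ℚP.pos⇒nonZero v
      w-nonZero : ℚ.NonZero w
      w-nonZero = ℚP.pos⇒nonZero w
      cycleTime-positive : ℚ.Positive cycleTime
      cycleTime-positive = ℚP.1/pos⇒pos v
      walkTime-positive : ℚ.Positive walkTime
      walkTime-positive = ℚP.1/pos⇒pos w

  cycleTime<walkTime : cycleTime ℚ.< walkTime
  cycleTime<walkTime =
    subst₂ ℚ._<_ cancel-w cancel-v (ℚP.*-monoˡ-<-pos walkTime (ℚP.*-monoʳ-<-pos cycleTime w<v))
    where
    open ≡-Reasoning
    cancel-w : cycleTime * w * walkTime ≡ cycleTime
    cancel-w = begin
      cycleTime * w * walkTime   ≡⟨ ℚP.*-assoc cycleTime w walkTime ⟩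
      cycleTime * (w * walkTime) ≡⟨ cong (cycleTime *_) (ℚP.*-inverseʳ w) ⟩
      cycleTime * ℚ.1ℚ           ≡⟨ ℚP.*-identityʳ cycleTime ⟩
      cycleTime                  ∎
    cancel-v : cycleTime * v * walkTime ≡ walkTime
    cancel-v = begin
      cycleTime * v * walkTime ≡⟨ cong (_* walkTime) (ℚP.*-inverseˡ v) ⟩
      ℚ.1ℚ * walkTime          ≡⟨ ℚP.*-identityˡ walkTime ⟩
      walkTime                 ∎

  gain : ℚ
  gain = walkTime - cycleTime

  gain-positive : 0ℚ ℚ.< gain
  gain-positive = subst (ℚ._< gain) (ℚP.+-inverseʳ cycleTime) (ℚP.+-monoˡ-< (- cycleTime) cycleTime<walkTime)

  cycleTime+gain≡walkTime : cycleTime + gain ≡ walkTime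
  cycleTime+gain≡walkTime = begin
    cycleTime + (walkTime - cycleTime) ≡⟨ ℚP.+-comm cycleTime _ ⟩
    walkTime - cycleTime + cycleTime   ≡⟨ ℚP.+-assoc walkTime (- cycleTime) cycleTime ⟩
    walkTime + (- cycleTime + cycleTime) ≡⟨ cong (walkTime +_) (ℚP.+-inverseˡ cycleTime) ⟩
    walkTime + 0ℚ                      ≡⟨ ℚP.+-identityʳ walkTime ⟩
    walkTime                           ∎
    where open ≡-Reasoning

  saving : ℕ → ℚ
  saving zero    = 0ℚ
  saving (suc m) = gain + saving m

  saving-<-suc : ∀ m → saving m ℚ.< saving (suc m)
  saving-<-suc m = subst (ℚ._< saving (suc m)) (ℚP.+-identityˡ (saving m)) (ℚP.+-monoˡ-< (saving m) gain-positive)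

  saving-mono-≤ : ∀ {m m'} → m ≤ m' → saving m ℚ.≤ saving m'
  saving-mono-≤ {m' = zero}   ℕ.z≤n     = ℚP.≤-refl
  saving-mono-≤ {m' = suc m'} ℕ.z≤n     = ℚP.≤-trans (saving-mono-≤ {m' = m'} ℕ.z≤n) (ℚP.<⇒≤ (saving-<-suc m'))
  saving-mono-≤               (ℕ.s≤s p) = ℚP.+-monoʳ-≤ gain (saving-mono-≤ p)

  saving-mono-< : ∀ {m m'} → m ℕ.< m' → saving m ℚ.< saving m'
  saving-mono-< {m} (ℕ.s≤s p) = ℚP.<-≤-trans (saving-<-suc m) (saving-mono-≤ (ℕ.s≤s p))

  journey-+-saving : ∀ {n} (P h : Fin n → Bool) →
    sumℚ (λ l → if P l then stageTime sp (h l) else 0ℚ) + saving (count (λ l → P l ∧ h l))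
      ≡ sumℚ (λ l → if P l then walkTime else 0ℚ)
  journey-+-saving {zero}  P h = refl
  journey-+-saving {suc n} P h =
    first-stage (P Fin.zero) (h Fin.zero) (journey-+-saving (λ l → P (Fin.suc l)) (λ l → h (Fin.suc l)))
    where
    first-stage : ∀ b c {S C T} → S + saving C ≡ T →
      (if b then stageTime sp c else 0ℚ) + S + saving ((if b ∧ c then 1 else 0) ℕ.+ C)
        ≡ (if b then walkTime else 0ℚ) + T
    first-stage true  true  {S} {C} eq =
      trans (interchange cycleTime S gain (saving C)) (cong₂ _+_ cycleTime+gain≡walkTime eq)
    first-stage true  false {S} {C} eq = trans (ℚP.+-assoc walkTime S (saving C)) (cong (walkTime +_) eq)
    first-stage false c     {S} {C} eq = trans (ℚP.+-assoc 0ℚ S (saving C)) (cong (0ℚ +_) eq)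

  arrival-+-saving : ∀ {n} (M : BinMatrix n) i p →
    arrival sp M i p + saving (cycled M i p) ≡ sumℚ {n} (λ l → if ⌊ toℕ l ℕ.<? p ⌋ then walkTime else 0ℚ)
  arrival-+-saving M i p = journey-+-saving (λ l → ⌊ toℕ l ℕ.<? p ⌋) (M i)

  arrival-≤⇒cycled-≥ : ∀ {n} (M : BinMatrix n) a b p →
    arrival sp M a p ℚ.≤ arrival sp M b p → cycled M b p ≤ cycled M a p
  arrival-≤⇒cycled-≥ M a b p arr≤ = ℕP.≮⇒≥ λ cyc< → ℚP.<-irrefl
    (trans (arrival-+-saving M a p) (sym (arrival-+-saving M b p)))
    (ℚP.+-mono-≤-< arr≤ (saving-mono-< cyc<))

  cycled-≥⇒arrival-≤ : ∀ {n} (M : BinMatrix n) a b p →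
    cycled M b p ≤ cycled M a p → arrival sp M a p ℚ.≤ arrival sp M b p
  cycled-≥⇒arrival-≤ M a b p cyc≤ = ℚP.≮⇒≥ λ arr< → ℚP.<-irrefl
    (trans (arrival-+-saving M b p) (sym (arrival-+-saving M a p)))
    (ℚP.+-mono-<-≤ arr< (saving-mono-≤ cyc≤))

Members : ∀ {n} → (Fin n → Bool) → Set
Members {n} f = Σ[ i ∈ Fin n ] f i ≡ true

module _ {n} {f : Fin n → Bool} where

  Members-≡ : {r s : Members f} → proj₁ r ≡ proj₁ s → r ≡ s
  Members-≡ {i , p} {.i , q} refl = cong (i ,_) (Decidable⇒UIP.≡-irrelevant BoolP._≟_ p q)

  _≟ᴹ_ : DecidableEquality (Members f)
  r ≟ᴹ s = map′ Members-≡ (cong proj₁) (proj₁ r FinP.≟ proj₁ s)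

≡true↔Fin : (b : Bool) → (b ≡ true) ↔ Fin (if b then 1 else 0)
≡true↔Fin true  = mk↔ₛ′ (λ _ → Fin.zero) (λ _ → refl) (λ { Fin.zero → refl ; (Fin.suc ()) }) (λ { refl → refl })
≡true↔Fin false = mk↔ₛ′ (λ ()) (λ ()) (λ ()) (λ ())

Members-suc↔ : ∀ {n} (f : Fin (suc n) → Bool) → Members f ↔ (f Fin.zero ≡ true ⊎ Members (λ l → f (Fin.suc l)))
Members-suc↔ f = mk↔ₛ′ to from to∘from from∘to
  where
  to : Members f → f Fin.zero ≡ true ⊎ Members (λ l → f (Fin.suc l))
  to (Fin.zero  , p) = inj₁ p
  to (Fin.suc i , p) = inj₂ (i , p)
  from : f Fin.zero ≡ true ⊎ Members (λ l → f (Fin.suc l)) → Members f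
  from (inj₁ p)       = Fin.zero , p
  from (inj₂ (i , p)) = Fin.suc i , p
  to∘from : ∀ x → to (from x) ≡ x
  to∘from (inj₁ p) = refl
  to∘from (inj₂ r) = refl
  from∘to : ∀ r → from (to r) ≡ r
  from∘to (Fin.zero  , p) = refl
  from∘to (Fin.suc i , p) = refl

Members↔Fin-count : ∀ {n} (f : Fin n → Bool) → Members f ↔ Fin (count f)
Members↔Fin-count {zero}  f = mk↔ₛ′ (λ ()) (λ ()) (λ ()) (λ ())
Members↔Fin-count {suc n} f =
  ↔-trans (Members-suc↔ f)
    (↔-trans (≡true↔Fin (f Fin.zero) ⊎-↔ Members↔Fin-count (λ l → f (Fin.suc l))) (↔-sym FinP.+↔⊎))

count≤n : ∀ {n} (f : Fin n → Bool) → count f ≤ n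
count≤n f = FinP.injective⇒≤ {f = proj₁ ∘ Inverse.from e}
  (λ eq → Injection.injective (↔⇒↣ (↔-sym e)) (Members-≡ eq))
  where e = Members↔Fin-count f

injective⇒strictlySurjective : ∀ {k} {h : Fin k → Fin k} → Injective _≡_ _≡_ h → StrictlySurjective _≡_ h
injective⇒strictlySurjective {suc k} {h} inj y with FinP.any? (λ x → h x FinP.≟ y)
... | yes hit  = hit
... | no  miss = contradiction (FinP.injective⇒≤ {f = λ x → Fin.punchOut (avoid x)} punchOut-inj) ℕP.1+n≰n
  where
  avoid : ∀ x → y ≢ h x
  avoid x y≡hx = miss (x , sym y≡hx)
  punchOut-inj : Injective _≡_ _≡_ (λ x → Fin.punchOut (avoid x))
  punchOut-inj eq = inj (FinP.punchOut-injective (avoid _) (avoid _) eq)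

-- The forward map of the resulting inverse is h itself.
injective⇒↔ : ∀ {A : Set} {k} → A ↔ Fin k → (h : A → Fin k) → Injective _≡_ _≡_ h → A ↔ Fin k
injective⇒↔ e h inj = ⤖⇒↔ (mk⤖ (inj , strictlySurjective⇒surjective onto))
  where
  onto : StrictlySurjective _≡_ h
  onto y with x , hx≡y ← injective⇒strictlySurjective {h = h ∘ Inverse.from e}
                           (λ eq → Injection.injective (↔⇒↣ (↔-sym e)) (inj eq)) y
    = Inverse.from e x , hx≡y

module Transposition {A : Set} (_≟_ : DecidableEquality A) (x y : A) where

  transpose : A → A
  transpose z with z ≟ x
  ... | yes _ = y
  ... | no  _ with z ≟ y
  ...   | yes _ = x
  ...   | no  _ = z

  transpose-left : transpose x ≡ y
  transpose-left with x ≟ x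
  ... | yes _   = refl
  ... | no  x≢x = contradiction refl x≢x

  transpose-right : transpose y ≡ x
  transpose-right with y ≟ x
  ... | yes y≡x = y≡x
  ... | no  _ with y ≟ y
  ...   | yes _   = refl
  ...   | no  y≢y = contradiction refl y≢y

  transpose-other : ∀ {z} → z ≢ x → z ≢ y → transpose z ≡ z
  transpose-other {z} z≢x z≢y with z ≟ x
  ... | yes z≡x = contradiction z≡x z≢x
  ... | no  _ with z ≟ y
  ...   | yes z≡y = contradiction z≡y z≢y
  ...   | no  _   = refl

  transpose-involutive : ∀ z → transpose (transpose z) ≡ z
  transpose-involutive z = by-cases (z ≟ x) (z ≟ y)
    where
    by-cases : Dec (z ≡ x) → Dec (z ≡ y) → transpose (transpose z) ≡ z
    by-cases (yes z≡x) _ =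
      trans (cong (transpose ∘ transpose) z≡x) (trans (cong transpose transpose-left) (trans transpose-right (sym z≡x)))
    by-cases (no _) (yes z≡y) =
      trans (cong (transpose ∘ transpose) z≡y) (trans (cong transpose transpose-right) (trans transpose-left (sym z≡y)))
    by-cases (no z≢x) (no z≢y) =
      trans (cong transpose (transpose-other z≢x z≢y)) (transpose-other z≢x z≢y)

  transpose↔ : A ↔ A
  transpose↔ = mk↔ₛ′ transpose transpose transpose-involutive transpose-involutive

module Repair {n} (f g : Fin n → Bool) (c : Fin n → ℕ) where

  record NonIncreasing↔ : Set where
    field
      bijection     : Members f ↔ Members g
      nonIncreasing : ∀ a → c (proj₁ (Inverse.to bijection a)) ≤ c (proj₁ a)

  open NonIncreasing↔

  Fixes : NonIncreasing↔ → Fin n → Set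
  Fixes φ p = (fp : f p ≡ true) → g p ≡ true → proj₁ (Inverse.to (bijection φ) (p , fp)) ≡ p

  -- The member a with φ a = i now goes to φ i, and c (φ i) ≤ c i = c (φ a) ≤ c a.
  redirect : (φ : NonIncreasing↔) (i : Fin n) → f i ≡ true → g i ≡ true →
             Σ NonIncreasing↔ λ ψ → Fixes ψ i × (∀ p → Fixes φ p → Fixes ψ p)
  redirect φ i fi gi = ψ , ψ-fixes-i , ψ-keeps
    where
    to : Members f → Members g
    to = Inverse.to (bijection φ)
    to-injective : Injective _≡_ _≡_ to
    to-injective = Injection.injective (↔⇒↣ (bijection φ))
    a₀ : Members f
    a₀ = i , fi
    b₀ : Members g
    b₀ = i , gi
    open Transposition _≟ᴹ_ (to a₀) b₀

    ψ-nonIncreasing : ∀ a → c (proj₁ (transpose (to a))) ≤ c (proj₁ a)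
    ψ-nonIncreasing a with proj₁ a FinP.≟ i
    ... | yes a≡i = ℕP.≤-reflexive (cong c
                      (trans (cong (proj₁ ∘ transpose ∘ to) (Members-≡ a≡i)) (trans (cong proj₁ transpose-left) (sym a≡i))))
    ... | no  a≢i with to a ≟ᴹ b₀
    ...   | yes ta≡b₀ = begin
              c (proj₁ (transpose (to a))) ≡⟨ cong (c ∘ proj₁) (trans (cong transpose ta≡b₀) transpose-right) ⟩
              c (proj₁ (to a₀))             ≤⟨ nonIncreasing φ a₀ ⟩
              c i                           ≡⟨ cong (c ∘ proj₁) (sym ta≡b₀) ⟩
              c (proj₁ (to a))              ≤⟨ nonIncreasing φ a ⟩
              c (proj₁ a)                   ∎
              where open ℕP.≤-Reasoning
    ...   | no  ta≢b₀ = subst (λ z → c (proj₁ z) ≤ c (proj₁ a))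
                          (sym (transpose-other (a≢i ∘ cong proj₁ ∘ to-injective) ta≢b₀)) (nonIncreasing φ a)

    ψ : NonIncreasing↔
    ψ = record { bijection = ↔-trans (bijection φ) transpose↔ ; nonIncreasing = ψ-nonIncreasing }

    ψ-fixes-i : Fixes ψ i
    ψ-fixes-i fp _ = cong proj₁ (trans (cong (transpose ∘ to) (Members-≡ refl)) transpose-left)

    ψ-keeps : ∀ p → Fixes φ p → Fixes ψ p
    ψ-keeps p φ-fixes-p fp gp with p FinP.≟ i
    ... | yes refl = ψ-fixes-i fp gp
    ... | no  p≢i  = trans (cong proj₁ (transpose-other (p≢i ∘ cong proj₁ ∘ to-injective)
                                                          (p≢i ∘ trans (sym (φ-fixes-p fp gp)) ∘ cong proj₁)))
                           (φ-fixes-p fp gp)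

  fix-one : (φ : NonIncreasing↔) (i : Fin n) → Σ NonIncreasing↔ λ ψ → Fixes ψ i × (∀ p → Fixes φ p → Fixes ψ p)
  fix-one φ i = by-cases (f i) (g i) refl refl
    where
    by-cases : ∀ b b' → f i ≡ b → g i ≡ b' → Σ NonIncreasing↔ λ ψ → Fixes ψ i × (∀ p → Fixes φ p → Fixes ψ p)
    by-cases true  true  fi gi = redirect φ i fi gi
    by-cases true  false _  gi = φ , (λ _ gp → contradiction (trans (sym gi) gp) λ ()) , (λ _ fixes → fixes)
    by-cases false _     fi _  = φ , (λ fp _ → contradiction (trans (sym fi) fp) λ ()) , (λ _ fixes → fixes)

  fix-list : (ps : List (Fin n)) → NonIncreasing↔ → Σ NonIncreasing↔ λ ψ → ∀ {p} → p ∈ ps → Fixes ψ p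
  fix-list []       φ = φ , λ ()
  fix-list (p ∷ ps) φ with ψ , ψ-fixes ← fix-list ps φ with χ , χ-fixes-p , χ-keeps ← fix-one ψ p
    = χ , λ { (here refl) → χ-fixes-p ; (there q∈ps) → χ-keeps _ (ψ-fixes q∈ps) }

  fix-all : NonIncreasing↔ → Σ NonIncreasing↔ λ ψ → ∀ p → Fixes ψ p
  fix-all φ with ψ , ψ-fixes ← fix-list (allFin n) φ = ψ , λ p → ψ-fixes (∈-allFin p)

label-chain : ∀ {m} {B : Set} (A : Fin (suc m) → Set) →
  A Fin.zero ↔ B → (∀ i → A (Fin.inject₁ i) ↔ A (Fin.suc i)) → ∀ j → A j ↔ B
label-chain         A base step Fin.zero    = base
label-chain {suc m} A base step (Fin.suc i) =
  label-chain (A ∘ Fin.suc) (↔-trans (↔-sym (step Fin.zero)) base) (step ∘ Fin.suc) i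

label-chain-suc : ∀ {m} {B : Set} (A : Fin (suc m) → Set) (base : A Fin.zero ↔ B)
  (step : ∀ i → A (Fin.inject₁ i) ↔ A (Fin.suc i)) i x →
  Inverse.to (label-chain A base step (Fin.suc i)) x
    ≡ Inverse.to (label-chain A base step (Fin.inject₁ i)) (Inverse.from (step i) x)
label-chain-suc {suc m} A base step Fin.zero    x = refl
label-chain-suc {suc m} A base step (Fin.suc i) x =
  label-chain-suc (A ∘ Fin.suc) (↔-trans (↔-sym (step Fin.zero)) base) (step ∘ Fin.suc) i x

next-inject₁ : ∀ {m} (i : Fin m) → Next (Fin.inject₁ i) (Fin.suc i)
next-inject₁ i = cong suc (sym (FinP.toℕ-inject₁ i))

next⇒inject₁ : ∀ {m} {j : Fin (suc m)} {i : Fin m} → Next j (Fin.suc i) → j ≡ Fin.inject₁ i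
next⇒inject₁ {i = i} nx = FinP.toℕ-injective (trans (sym (ℕP.suc-injective nx)) (sym (FinP.toℕ-inject₁ i)))

Admissible : ∀ {n} (M : BinMatrix n) (j j' : Fin n) → AssignmentMapping M j j' → Set
Admissible M j j' φ =
  (∀ (r : Riders M j) →
    (proj₁ (Bijection.to φ r) ≡ proj₁ r → M (proj₁ r) j' ≡ true) ×
    (M (proj₁ r) j' ≡ true → proj₁ (Bijection.to φ r) ≡ proj₁ r)) ×
  (∀ (r : Riders M j) →
    cycled M (proj₁ (Bijection.to φ r)) (suc (toℕ j)) ≤ cycled M (proj₁ r) (suc (toℕ j)))

AdmissibleAssignments : ∀ {n} → BinMatrix n → Set
AdmissibleAssignments {n} M = ∀ (j j' : Fin n) → Next j j' → Σ (AssignmentMapping M j j') (Admissible M j j')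

-- With no travellers every k is uniform, so the witness is replaced by 0.
uniform⇒bounded : ∀ {n k} {M : BinMatrix n} → Uniform k M → ∃[ k' ] (k' ≤ n × Uniform k' M)
uniform⇒bounded {zero}          _                 = 0 , ℕ.z≤n , (λ ()) , (λ ())
uniform⇒bounded {suc n} {k} {M} uniform@(rows , _) =
  k , subst (_≤ suc n) (rows Fin.zero) (count≤n (M Fin.zero)) , uniform

module Forward (sp : Speeds) {n} (M : BinMatrix n) {k} (cols : ∀ j → count (λ i → M i j) ≡ k)
               (execution : NoWaitExecution sp M k) where
  open NoWaitExecution execution
  open Timing sp

  bikes : ∀ j → Riders M j ↔ Fin k
  bikes j = injective⇒↔ (subst (λ c → Riders M j ↔ Fin c) (cols j) (Members↔Fin-count (λ i → M i j)))
                        (bike j) (oneRider j)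

  handover : ∀ j j' → Next j j' → Repair.NonIncreasing↔ (λ i → M i j) (λ i → M i j') (λ i → cycled M i (suc (toℕ j)))
  handover j j' nx = record { bijection = ↔-trans (bikes j) (↔-sym (bikes j')) ; nonIncreasing = nonIncreasing }
    where
    nonIncreasing : ∀ a → cycled M (proj₁ (Inverse.from (bikes j') (bike j a))) (suc (toℕ j))
                            ≤ cycled M (proj₁ a) (suc (toℕ j))
    nonIncreasing a with present j j' nx (Inverse.from (bikes j') (bike j a))
    ... | r , same-bike , arrived-first =
      subst (λ r → cycled M _ (suc (toℕ j)) ≤ cycled M (proj₁ r) (suc (toℕ j)))
        (oneRider j (trans same-bike (Inverse.strictlyInverseˡ (bikes j') (bike j a))))
        (arrival-≤⇒cycled-≥ M (proj₁ r) _ (suc (toℕ j)) arrived-first)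

  assignments : AdmissibleAssignments M
  assignments j j' nx with ψ , ψ-fixes ← Repair.fix-all _ _ _ (handover j j' nx) =
    ↔⇒⤖ bijection ,
    (λ r → (λ stays → subst (λ i → M i j' ≡ true) stays (proj₂ (Inverse.to bijection r))) ,
           ψ-fixes (proj₁ r) (proj₂ r)) ,
    nonIncreasing
    where open Repair.NonIncreasing↔ ψ

module Backward (sp : Speeds) {m} (M : BinMatrix (suc m)) {k} (cols : ∀ j → count (λ i → M i j) ≡ k)
                (assignments : AdmissibleAssignments M) where
  open Timing sp

  φ : ∀ j j' → Next j j' → Riders M j ↔ Riders M j'
  φ j j' nx = ⤖⇒↔ (proj₁ (assignments j j' nx))

  bikes : ∀ j → Riders M j ↔ Fin k
  bikes = label-chain (Riders M)
    (subst (λ c → Riders M Fin.zero ↔ Fin c) (cols Fin.zero) (Members↔Fin-count (λ i → M i Fin.zero)))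
    (λ i → φ (Fin.inject₁ i) (Fin.suc i) (next-inject₁ i))

  bikes-next : ∀ j j' (nx : Next j j') r' →
    Inverse.to (bikes j') r' ≡ Inverse.to (bikes j) (Inverse.from (φ j j' nx) r')
  bikes-next j (Fin.suc i) nx r' with refl ← next⇒inject₁ nx with refl ← ℕP.≡-irrelevant nx (next-inject₁ i) =
    label-chain-suc (Riders M) _ _ i r'

  execution : NoWaitExecution sp M k
  execution = record
    { bike     = Inverse.to ∘ bikes
    ; oneRider = λ j → Injection.injective (↔⇒↣ (bikes j))
    ; present  = present
    }
    where
    present : ∀ j j' → Next j j' → (r' : Riders M j') →
      ∃[ r ] (Inverse.to (bikes j) r ≡ Inverse.to (bikes j') r' ×
              arrival sp M (proj₁ r) (suc (toℕ j)) ℚ.≤ arrival sp M (proj₁ r') (suc (toℕ j)))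
    present j j' nx r' = r , sym (bikes-next j j' nx r') ,
      cycled-≥⇒arrival-≤ M (proj₁ r) (proj₁ r') (suc (toℕ j))
        (subst (λ r' → cycled M (proj₁ r') (suc (toℕ j)) ≤ cycled M (proj₁ r) (suc (toℕ j)))
          (Inverse.strictlyInverseˡ (φ j j' nx) r') (proj₂ (proj₂ (assignments j j' nx)) r))
      where r = Inverse.from (φ j j' nx) r'

no-wait-execution : ∀ (sp : Speeds) {n} (M : BinMatrix n) {k} → (∀ j → count (λ i → M i j) ≡ k) →
  AdmissibleAssignments M → NoWaitExecution sp M k
no-wait-execution sp {zero}  M cols assignments = record { bike = λ () ; oneRider = λ () ; present = λ () }
no-wait-execution sp {suc m} M cols assignments = Backward.execution sp M cols assignments

theorem3p2 : ∀ (sp : Speeds) (n : ℕ) (M : BinMatrix n) →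
    Optimal sp M ⇔
    (∃[ k ] (k ≤ n × Uniform k M) ×
     (∀ (j j' : Fin n) → Next j j' →
       Σ (AssignmentMapping M j j') λ φ →
         (∀ (r : Riders M j) →
           (proj₁ (Bijection.to φ r) ≡ proj₁ r → M (proj₁ r) j' ≡ true) ×
           (M (proj₁ r) j' ≡ true → proj₁ (Bijection.to φ r) ≡ proj₁ r)) ×
         (∀ (r : Riders M j) →
           cycled M (proj₁ (Bijection.to φ r)) (suc (toℕ j)) ≤ cycled M (proj₁ r) (suc (toℕ j)))))
theorem3p2 sp n M = mk⇔
  (λ { (_ , uniform@(_ , cols) , execution) →
         let k , k≤n , uniform′ = uniform⇒bounded uniform
         in  k , (k≤n , uniform′) , Forward.assignments sp M cols execution })
  (λ { (k , (_ , uniform@(_ , cols)) , assignments) → k , uniform , no-wait-execution sp M cols assignments })
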